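{- Let $\mathbf{s}=(1,2,\dots,n)$ and $\mathbf{s}^*=(1,2,\dots,n,1)$. Let $\pi$ be the map dropping the last coordinate of a vector. Then the composition $\operatorname{reverse}\circ\pi\circ\overline{\operatorname{REM}}_{\mathbf{s}^*}$ is a bijection from $\operatorname{Par}_{\mathbf{s}^*}\cap\mathbb{Z}^{n+1}$ to the set $\langle n-1\rangle\times\langle n-2\rangle\times\cdots\times\langle 0\rangle$ of inversion sequences of length $n$. Furthermore, for every $\mathbf{x}\in\operatorname{Par}_{\mathbf{s}^*}\cap\mathbb{Z}^{n+1}$, \[\text{the last coordinate of }\mathbf{x}=\operatorname{asc}\big(\pi(\overline{\operatorname{REM}}_{\mathbf{s}^*}(\mathbf{x}))\big)=\operatorname{des}\big(\operatorname{reverse}(\pi(\overline{\operatorname{REM}}_{\mathbf{s}^*}(\mathbf{x})))\big).\]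
   Context: $\langle N\rangle=\{0,\dots,N\}$. For a sequence $\mathbf{t}=(t_1,\dots,t_m)$ of positive integers, $\operatorname{Par}_{\mathbf{t}}=\{\sum_{j=1}^m c_j\mathbf{w}_j: 0\le c_j<1\}\subset\mathbb{R}^m$ with $\mathbf{w}_j=(0,\dots,0,t_j,\dots,t_m)$ ($j-1$ leading zeros). For $\mathbf{t}=\mathbf{s}^*=(t_1,\dots,t_{n+1})$, the map $\overline{\operatorname{REM}}_{\mathbf{s}^*}:\operatorname{Par}_{\mathbf{s}^*}\cap\mathbb{Z}^{n+1}\to\langle t_1-1\rangle\times\cdots\times\langle t_{n+1}-1\rangle$ sends $\mathbf{x}$ to $\mathbf{z}$ with $z_i\in\langle t_i-1\rangle$ and $x_i+z_i\equiv0\pmod{t_i}$. $\operatorname{reverse}$ reverses a sequence. For $\mathbf{r}\in\mathbb{N}^m$, $\operatorname{asc}(\mathbf{r})=\#\{i\le m-1: r_i<r_{i+1}\}$ and $\operatorname{des}(\mathbf{r})=\#\{i\le m-1: r_i>r_{i+1}\}$. -}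

module Defs where

open import Data.Nat as ℕ using (ℕ; zero; suc; _<ᵇ_; _∸_)
open import Data.Integer as ℤ using (ℤ; +_; -_)
open import Data.Integer.DivMod using (_%ℕ_)
open import Data.Rational as ℚ using (ℚ; 0ℚ; 1ℚ; _/_)
open import Data.Fin using (Fin; toℕ) renaming (zero to fzero; suc to fsuc)
open import Data.Vec using (Vec; lookup; tabulate; _∷ʳ_; init; reverse; toList)
open import Data.List using (List; []; _∷_)
open import Data.Bool using (if_then_else_)
open import Data.Product using (Σ; _×_)
open import Relation.Binary.PropositionalEquality using (_≡_)

∑ : ∀ {m} → (Fin m → ℚ) → ℚ
∑ {zero}  f = 0ℚ
∑ {suc m} f = f fzero ℚ.+ ∑ (λ j → f (fsuc j))

ℕ→ℚ : ℕ → ℚ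
ℕ→ℚ k = (+ k) / 1

ℤ→ℚ : ℤ → ℚ
ℤ→ℚ z = z / 1

-- i-th coordinate of w_j = (0,…,0,t_j,…,t_m)  (j-1 leading zeros, 1-indexed)
w : ∀ {m} → Vec ℕ m → Fin m → Fin m → ℕ
w t j i = if toℕ i <ᵇ toℕ j then 0 else lookup t i

-- x ∈ Par_t ∩ ℤ^m : x = ∑_j c_j w_j with 0 ≤ c_j < 1.
-- (Coefficients range over ℚ: since the w_j form a triangular basis with
--  nonzero diagonal, the c_j of an integer point are unique and rational.)
InPar : ∀ {m} → Vec ℕ m → Vec ℤ m → Set
InPar {m} t x =
  Σ (Vec ℚ m) λ c →
    (∀ j → (0ℚ ℚ.≤ lookup c j) × (lookup c j ℚ.< 1ℚ)) ×
    (∀ i → ℤ→ℚ (lookup x i) ≡ ∑ (λ j → lookup c j ℚ.* ℕ→ℚ (w t j i)))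

-- the unique z ∈ ⟨t-1⟩ with x + z ≡ 0 (mod t), for t ≥ 1
-- (the value for t = 0 is an irrelevant junk value)
negRem : ℤ → ℕ → ℕ
negRem x zero    = 0
negRem x (suc k) = (- x) %ℕ (suc k)

REMbar : ∀ {m} → Vec ℕ m → Vec ℤ m → Vec ℕ m
REMbar t x = tabulate (λ i → negRem (lookup x i) (lookup t i))

sStar : (n : ℕ) → Vec ℕ (suc n)
sStar n = tabulate {n = n} (λ i → suc (toℕ i)) ∷ʳ 1

π : ∀ {n} {A : Set} → Vec A (suc n) → Vec A n
π = init

asc : List ℕ → ℕ
asc []            = 0
asc (a ∷ [])      = 0
asc (a ∷ b ∷ r)   = (if a <ᵇ b then 1 else 0) ℕ.+ asc (b ∷ r)

des : List ℕ → ℕ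
des []            = 0
des (a ∷ [])      = 0
des (a ∷ b ∷ r)   = (if b <ᵇ a then 1 else 0) ℕ.+ des (b ∷ r)

-- inversion sequences of length n: ⟨n-1⟩ × ⟨n-2⟩ × ⋯ × ⟨0⟩  (0-indexed i ↦ ⟨n-1-i⟩)
InvSeq : (n : ℕ) → Vec ℕ n → Set
InvSeq n e = ∀ i → lookup e i ℕ.< n ∸ toℕ i

Φ : (n : ℕ) → Vec ℤ (suc n) → Vec ℕ n
Φ n x = reverse (π (REMbar (sStar n) x))

-- The core is proved for arbitrary weights t_k = 1 + d_k (module Weighted), with sentinels
-- x_{-1} = 0, t_{-1} = 1. (1) A point ∑ c_j w_j has coordinates x_k = t_k(c_0 + ⋯ + c_k), so
-- x ∈ Par_t iff every c_k = x_k/t_k − x_{k-1}/t_{k-1} lies in [0,1), i.e. iff the local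
-- inequalities t_k x_{k-1} ≤ t_{k-1} x_k < t_k x_{k-1} + t_{k-1} t_k hold. (2) Writing
-- x_k = t_k B_k − z_k with z = REM̄_t x, an integer window argument turns the k-th inequality
-- into B_k = B_{k-1} + [z_{k-1}/t_{k-1} < z_k/t_k]; by induction x ∈ Par_t iff
-- x_k = t_k·wasc_{k+1}(z) − z_k, with wasc counting these weighted ascents. (3) Hence REM̄_t is a
-- bijection from Par_t ∩ ℤ^m onto the box ∏ ⟨t_k − 1⟩. For t = s* (module SStar) the last
-- remainder is 0, weighted ascents are ordinary ascents, and the box ⟨0⟩ × ⋯ × ⟨n−1⟩ is the
-- reversal of the set of inversion sequences; the theorem follows.

module Submission where

open import Defs
open import Data.Nat using (ℕ; suc)
open import Data.Integer using (ℤ; +_)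
open import Data.Vec using (Vec; last; reverse; toList)
open import Data.Product using (Σ; _×_)
open import Relation.Binary.PropositionalEquality using (_≡_)

open import Data.Nat as Nat using (zero; _<ᵇ_; _∸_; z≤n; s≤s)
open import Data.Nat.Properties as ℕP using ()
open import Data.Fin using (Fin; toℕ; fromℕ<) renaming (zero to fzero; suc to fsuc)
import Data.Fin.Properties as FinP
open import Data.Vec using ([]; _∷_; lookup; tabulate; init; _∷ʳ_)
import Data.Vec.Properties as VecP
open import Data.List as List using (List) renaming ([] to []ₗ; _∷_ to _∷ₗ_)
import Data.List.Properties as ListP
open import Data.Bool using (true; false; if_then_else_; T)
open import Data.Empty using (⊥-elim)
open import Data.Product using (_,_; proj₁; proj₂)
open import Data.Sum using (_⊎_; inj₁; inj₂)
open import Relation.Nullary using (¬_; yes; no)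
open import Relation.Binary.PropositionalEquality
  using (refl; sym; trans; cong; cong₂; subst; subst₂; module ≡-Reasoning)
open import Function.Bundles using (_⇔_; mk⇔; Equivalence)
open import Function.Properties.Equivalence using () renaming (trans to ⇔-trans)
open import Data.Product.Function.NonDependent.Propositional using (_×-⇔_)
open Equivalence using (to; from)

private variable
  A : Set
  m n : ℕ

module Sequences where
  private variable k : ℕ

  at : A → Vec A m → ℕ → A
  at a₀ []      k       = a₀
  at a₀ (a ∷ v) zero    = a
  at a₀ (a ∷ v) (suc k) = at a₀ v k

  infixr 5 _◂_
  _◂_ : A → (ℕ → A) → ℕ → A
  (a ◂ f) zero    = a
  (a ◂ f) (suc k) = f k

  at-lookup : ∀ {a₀ : A} (v : Vec A m) (i : Fin m) → at a₀ v (toℕ i) ≡ lookup v i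
  at-lookup (a ∷ v) fzero    = refl
  at-lookup (a ∷ v) (fsuc i) = at-lookup v i

  at-lookup-fromℕ< : ∀ {a₀ : A} (v : Vec A m) (p : k Nat.< m) → lookup v (fromℕ< p) ≡ at a₀ v k
  at-lookup-fromℕ< {k = zero}  (a ∷ v) p       = refl
  at-lookup-fromℕ< {k = suc k} (a ∷ v) (s≤s p) = at-lookup-fromℕ< v p

  at-tabulate : ∀ {a₀ : A} (f : Fin m → A) (p : k Nat.< m) → at a₀ (tabulate f) k ≡ f (fromℕ< p)
  at-tabulate {m = suc m} {k = zero}  f p       = refl
  at-tabulate {m = suc m} {k = suc k} f (s≤s p) = at-tabulate (λ i → f (fsuc i)) p

  at-tabulate-toℕ : ∀ {a₀ : A} (g : ℕ → A) → k Nat.< m → at a₀ (tabulate {n = m} (λ i → g (toℕ i))) k ≡ g k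
  at-tabulate-toℕ g p = trans (at-tabulate (λ i → g (toℕ i)) p) (cong g (FinP.toℕ-fromℕ< p))

  at-ext : ∀ {a₀ : A} (u v : Vec A m) → (∀ k → k Nat.< m → at a₀ u k ≡ at a₀ v k) → u ≡ v
  at-ext []      []      h = refl
  at-ext (a ∷ u) (b ∷ v) h = cong₂ _∷_ (h 0 (s≤s z≤n)) (at-ext u v (λ k p → h (suc k) (s≤s p)))

  at-init : ∀ {a₀ : A} (v : Vec A (suc n)) → k Nat.< n → at a₀ (init v) k ≡ at a₀ v k
  at-init {n = suc n} {k = zero}  (a ∷ v) p       = refl
  at-init {n = suc n} {k = suc k} (a ∷ v) (s≤s p) = at-init v p

  last-at : ∀ {a₀ : A} (v : Vec A (suc n)) → last v ≡ at a₀ v n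
  last-at {n = zero}  (a ∷ []) = refl
  last-at {n = suc n} (a ∷ v)  = last-at v

  at-end : ∀ {a₀ : A} (v : Vec A n) → at a₀ v n ≡ a₀
  at-end []      = refl
  at-end (a ∷ v) = at-end v

  at-∷ʳ : ∀ {a₀ : A} (v : Vec A n) a → k Nat.< n → at a₀ (v ∷ʳ a) k ≡ at a₀ v k
  at-∷ʳ {k = zero}  (b ∷ v) a p       = refl
  at-∷ʳ {k = suc k} (b ∷ v) a (s≤s p) = at-∷ʳ v a p

  at-∷ʳ-end : ∀ {a₀ : A} (v : Vec A n) a → at a₀ (v ∷ʳ a) n ≡ a
  at-∷ʳ-end []      a = refl
  at-∷ʳ-end (b ∷ v) a = at-∷ʳ-end v a

  at-reverse : ∀ {a₀ : A} (v : Vec A n) → k Nat.< n → at a₀ (reverse v) k ≡ at a₀ v (n ∸ suc k)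
  at-reverse {n = suc n} {k = k} {a₀ = a₀} (a ∷ v) (s≤s k≤n) with ℕP.m≤n⇒m<n∨m≡n k≤n
  ... | inj₁ k<n = begin
    at a₀ (reverse (a ∷ v)) k      ≡⟨ cong (λ u → at a₀ u k) (VecP.reverse-∷ a v) ⟩
    at a₀ (reverse v ∷ʳ a) k       ≡⟨ at-∷ʳ (reverse v) a k<n ⟩
    at a₀ (reverse v) k            ≡⟨ at-reverse v k<n ⟩
    at a₀ v (n ∸ suc k)            ≡⟨ cong (at a₀ (a ∷ v)) (sym (ℕP.+-∸-assoc 1 k<n)) ⟩
    at a₀ (a ∷ v) (suc n ∸ suc k)  ∎
    where open ≡-Reasoning
  ... | inj₂ refl = begin
    at a₀ (reverse (a ∷ v)) k      ≡⟨ cong (λ u → at a₀ u k) (VecP.reverse-∷ a v) ⟩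
    at a₀ (reverse v ∷ʳ a) k       ≡⟨ at-∷ʳ-end (reverse v) a ⟩
    a                              ≡⟨ cong (at a₀ (a ∷ v)) (sym (ℕP.n∸n≡0 k)) ⟩
    at a₀ (a ∷ v) (k ∸ k)          ∎
    where open ≡-Reasoning

module Ascents where
  open Sequences using (at)
  open Nat using (_+_; _*_; _<_; _≤_)

  bit : ℕ → ℕ → ℕ
  bit a b = if a <ᵇ b then 1 else 0

  bit-< : ∀ {a b} → a < b → bit a b ≡ 1
  bit-< {a} {b} a<b with a <ᵇ b in eq
  ... | true  = refl
  ... | false = ⊥-elim (subst T eq (ℕP.<⇒<ᵇ a<b))

  bit-≮ : ∀ {a b} → ¬ a < b → bit a b ≡ 0
  bit-≮ {a} {b} a≮b with a <ᵇ b in eq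
  ... | true  = ⊥-elim (a≮b (ℕP.<ᵇ⇒< a b (subst T (sym eq) _)))
  ... | false = refl

  -- For z < D, comparing z/D with z'/(D+1) is the same as comparing z with z'.
  bit-scale : ∀ {D z} z' → z < D → bit (suc D * z) (D * z') ≡ bit z z'
  bit-scale {D} {z} z' z<D with z ℕP.<? z'
  ... | yes z<z' = trans (bit-< scaled) (sym (bit-< z<z'))
    where
    open ℕP.≤-Reasoning
    scaled : suc D * z < D * z'
    scaled = begin-strict
      z + D * z   <⟨ ℕP.+-monoˡ-< (D * z) z<D ⟩
      D + D * z   ≡⟨ sym (ℕP.*-suc D z) ⟩
      D * suc z   ≤⟨ ℕP.*-monoʳ-≤ D z<z' ⟩
      D * z'      ∎
  ... | no z≮z' = trans (bit-≮ (ℕP.≤⇒≯ scaled)) (sym (bit-≮ z≮z'))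
    where
    open ℕP.≤-Reasoning
    scaled : D * z' ≤ suc D * z
    scaled = begin
      D * z'      ≤⟨ ℕP.*-monoʳ-≤ D (ℕP.≮⇒≥ z≮z') ⟩
      D * z       ≤⟨ ℕP.m≤n+m (D * z) z ⟩
      z + D * z   ∎

  ascents : (ℕ → ℕ) → ℕ → ℕ
  ascents f zero          = 0
  ascents f (suc zero)    = 0
  ascents f (suc (suc k)) = ascents f (suc k) + bit (f k) (f (suc k))

  ascents-cons : ∀ f k → ascents f (suc (suc k)) ≡ bit (f 0) (f 1) + ascents (λ j → f (suc j)) (suc k)
  ascents-cons f zero    = ℕP.+-comm 0 (bit (f 0) (f 1))
  ascents-cons f (suc k) = begin
    ascents f (suc (suc k)) + bit (f (suc k)) (f (suc (suc k)))
      ≡⟨ cong (_+ bit (f (suc k)) (f (suc (suc k)))) (ascents-cons f k) ⟩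
    bit (f 0) (f 1) + ascents (λ j → f (suc j)) (suc k) + bit (f (suc k)) (f (suc (suc k)))
      ≡⟨ ℕP.+-assoc (bit (f 0) (f 1)) _ _ ⟩
    bit (f 0) (f 1) + ascents (λ j → f (suc j)) (suc (suc k))  ∎
    where open ≡-Reasoning

  ascents-cong : ∀ f g k → (∀ j → j < k → f j ≡ g j) → ascents f k ≡ ascents g k
  ascents-cong f g zero          h = refl
  ascents-cong f g (suc zero)    h = refl
  ascents-cong f g (suc (suc k)) h =
    cong₂ _+_ (ascents-cong f g (suc k) (λ j j<k → h j (ℕP.m<n⇒m<1+n j<k)))
              (cong₂ bit (h k (ℕP.m<n⇒m<1+n ℕP.≤-refl)) (h (suc k) ℕP.≤-refl))

  ascents-zero-end : ∀ f k → f k ≡ 0 → ascents f (suc k) ≡ ascents f k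
  ascents-zero-end f zero    _     = refl
  ascents-zero-end f (suc k) f[k]≡0 rewrite f[k]≡0 = ℕP.+-identityʳ (ascents f (suc k))

  asc-toList : (v : Vec ℕ m) → asc (toList v) ≡ ascents (at 0 v) m
  asc-toList []          = refl
  asc-toList (a ∷ [])    = refl
  asc-toList {m = suc (suc m)} (a ∷ b ∷ v) =
    trans (cong (λ u → bit a b + u) (asc-toList (b ∷ v))) (sym (ascents-cons (at 0 (a ∷ b ∷ v)) m))

  des-∷ʳ : ∀ (l : List ℕ) b a → des (l List.∷ʳ b List.∷ʳ a) ≡ des (l List.∷ʳ b) + bit a b
  des-∷ʳ []ₗ               b a = ℕP.+-comm (bit a b) 0
  des-∷ʳ (c ∷ₗ []ₗ)        b a =
    sym (trans (ℕP.+-assoc (bit b c) 0 (bit a b)) (cong (λ u → bit b c + u) (sym (ℕP.+-identityʳ (bit a b)))))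
  des-∷ʳ (c ∷ₗ c' ∷ₗ l)    b a =
    trans (cong (λ u → bit c' c + u) (des-∷ʳ (c' ∷ₗ l) b a)) (sym (ℕP.+-assoc (bit c' c) _ _))

  des-reverse : (l : List ℕ) → des (List.reverse l) ≡ asc l
  des-reverse []ₗ             = refl
  des-reverse (a ∷ₗ []ₗ)      = refl
  des-reverse (a ∷ₗ b ∷ₗ l) = begin
    des (List.reverse (a ∷ₗ b ∷ₗ l))
      ≡⟨ cong des (trans (ListP.unfold-reverse a (b ∷ₗ l)) (cong (List._∷ʳ a) (ListP.unfold-reverse b l))) ⟩
    des (List.reverse l List.∷ʳ b List.∷ʳ a)   ≡⟨ des-∷ʳ (List.reverse l) b a ⟩
    des (List.reverse l List.∷ʳ b) + bit a b  ≡⟨ cong (λ u → des u + bit a b) (sym (ListP.unfold-reverse b l)) ⟩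
    des (List.reverse (b ∷ₗ l)) + bit a b     ≡⟨ cong (_+ bit a b) (des-reverse (b ∷ₗ l)) ⟩
    asc (b ∷ₗ l) + bit a b                    ≡⟨ ℕP.+-comm (asc (b ∷ₗ l)) (bit a b) ⟩
    asc (a ∷ₗ b ∷ₗ l)                          ∎
    where open ≡-Reasoning

module IntegerShift where
  open import Data.Integer using (_+_; -_; _≤_; _<_)
  import Data.Integer.Properties as ℤP
  open import Data.Integer.Tactic.RingSolver using (solve-∀)

  +-neg-cancel : ∀ a c → a + c + - c ≡ a
  +-neg-cancel = solve-∀

  ≤-shift : ∀ c {a b a' b'} → a + c ≡ a' → b + c ≡ b' → a ≤ b ⇔ a' ≤ b'
  ≤-shift c {a} {b} refl refl = mk⇔ (ℤP.+-monoˡ-≤ c)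
    (λ h → subst₂ _≤_ (+-neg-cancel a c) (+-neg-cancel b c) (ℤP.+-monoˡ-≤ (- c) h))

  <-shift : ∀ c {a b a' b'} → a + c ≡ a' → b + c ≡ b' → a < b ⇔ a' < b'
  <-shift c {a} {b} refl refl = mk⇔ (ℤP.+-monoˡ-< c)
    (λ h → subst₂ _<_ (+-neg-cancel a c) (+-neg-cancel b c) (ℤP.+-monoˡ-< (- c) h))

module Rationals where
  open import Data.Rational using (ℚ; 0ℚ; 1ℚ; mkℚ; _+_; _*_; -_; _≤_; _<_; 1/_; *≤*; *<*)
  import Data.Rational.Properties as ℚP
  import Data.Integer as Int
  import Data.Integer.Properties as ℤP
  open import Data.Nat.Coprimality using (Coprime; 1-coprimeTo)
  import Data.Nat.Coprimality as Coprimality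

  coprime-1 : ∀ a → Coprime (Int.∣ a ∣) 1
  coprime-1 a = Coprimality.sym (1-coprimeTo _)

  ι-mkℚ : ∀ a → ℤ→ℚ a ≡ mkℚ a 0 (coprime-1 a)
  ι-mkℚ a = ℚP.↥p/↧p≡p (mkℚ a 0 (coprime-1 a))

  ι-+ : ∀ a b → ℤ→ℚ (a Int.+ b) ≡ ℤ→ℚ a + ℤ→ℚ b
  ι-+ a b rewrite ι-mkℚ a | ι-mkℚ b =
    cong ℤ→ℚ (cong₂ Int._+_ (sym (ℤP.*-identityʳ a)) (sym (ℤP.*-identityʳ b)))

  ι-* : ∀ a b → ℤ→ℚ (a Int.* b) ≡ ℤ→ℚ a * ℤ→ℚ b
  ι-* a b rewrite ι-mkℚ a | ι-mkℚ b = refl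

  ι-≤ : ∀ {a b} → a Int.≤ b ⇔ ℤ→ℚ a ≤ ℤ→ℚ b
  ι-≤ {a} {b} rewrite ι-mkℚ a | ι-mkℚ b = mk⇔
    (λ a≤b → *≤* (subst₂ Int._≤_ (sym (ℤP.*-identityʳ a)) (sym (ℤP.*-identityʳ b)) a≤b))
    (λ { (*≤* a≤b) → subst₂ Int._≤_ (ℤP.*-identityʳ a) (ℤP.*-identityʳ b) a≤b })

  ι-< : ∀ {a b} → a Int.< b ⇔ ℤ→ℚ a < ℤ→ℚ b
  ι-< {a} {b} rewrite ι-mkℚ a | ι-mkℚ b = mk⇔
    (λ a<b → *<* (subst₂ Int._<_ (sym (ℤP.*-identityʳ a)) (sym (ℤP.*-identityʳ b)) a<b))
    (λ { (*<* a<b) → subst₂ Int._<_ (ℤP.*-identityʳ a) (ℤP.*-identityʳ b) a<b })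

  -- The positive rational 1 + k, in a form whose positivity is visible to instance search.
  pos : ℕ → ℚ
  pos k = mkℚ (+ suc k) 0 (coprime-1 (+ suc k))

  ι-pos : ∀ k → ℤ→ℚ (+ suc k) ≡ pos k
  ι-pos k = ι-mkℚ (+ suc k)

  *-/pos : ∀ k a → ℕ→ℚ (suc k) * (a * 1/ pos k) ≡ a
  *-/pos k a = begin
    ℕ→ℚ (suc k) * (a * 1/ pos k)  ≡⟨ cong (_* (a * 1/ pos k)) (ι-pos k) ⟩
    pos k * (a * 1/ pos k)        ≡⟨ cong (pos k *_) (ℚP.*-comm a (1/ pos k)) ⟩
    pos k * (1/ pos k * a)        ≡⟨ sym (ℚP.*-assoc (pos k) (1/ pos k) a) ⟩
    pos k * 1/ pos k * a          ≡⟨ cong (_* a) (ℚP.*-inverseʳ (pos k)) ⟩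
    1ℚ * a                        ≡⟨ ℚP.*-identityˡ a ⟩
    a                             ∎
    where open ≡-Reasoning

  neg-+-cancel : ∀ a b → - a + (a + b) ≡ b
  neg-+-cancel a b = trans (sym (ℚP.+-assoc (- a) a b)) (trans (cong (_+ b) (ℚP.+-inverseˡ a)) (ℚP.+-identityˡ b))

  affine-≤ : ∀ a k w → (a ≤ a + pos k * w) ⇔ (0ℚ ≤ w)
  affine-≤ a k w = mk⇔
    (λ h → ℚP.*-cancelˡ-≤-pos (pos k) (subst₂ _≤_ (trans (ℚP.+-inverseˡ a) (sym (ℚP.*-zeroʳ (pos k))))
                                                 (neg-+-cancel a (pos k * w)) (ℚP.+-monoʳ-≤ (- a) h)))
    (λ h → subst₂ _≤_ (ℚP.+-identityʳ a) refl
             (ℚP.+-monoʳ-≤ a (subst (_≤ pos k * w) (ℚP.*-zeroʳ (pos k)) (ℚP.*-monoˡ-≤-nonNeg (pos k) h))))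

  affine-< : ∀ a k w → (a + pos k * w < a + pos k) ⇔ (w < 1ℚ)
  affine-< a k w = mk⇔
    (λ h → ℚP.*-cancelˡ-<-nonNeg (pos k) (subst₂ _<_ (neg-+-cancel a (pos k * w))
                                            (trans (neg-+-cancel a (pos k)) (sym (ℚP.*-identityʳ (pos k))))
                                            (ℚP.+-monoʳ-< (- a) h)))
    (λ h → ℚP.+-monoʳ-< a (subst (pos k * w <_) (ℚP.*-identityʳ (pos k)) (ℚP.*-monoʳ-<-pos (pos k) h)))

-- Step (1): coordinates of ∑ c_j w_j and the local inequalities.
module LocalInequalities where
  open import Data.Rational using (ℚ; 0ℚ; 1ℚ; _+_; _*_; _-_; _≤_; _<_)
  import Data.Rational.Properties as ℚP
  open import Data.Rational.Solver using (module +-*-Solver)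
  open +-*-Solver using (solve; _:=_; _:+_; _:*_; _:-_; con)
  import Data.Integer as Int
  open Sequences
  open Rationals

  -- The local inequalities between consecutive coordinates X = x_{k-1}, Y = x_k of a
  -- point of Par_t, for weights D = t_{k-1}, E = t_k:  E·X ≤ D·Y < E·X + D·E.
  Step : ℕ → ℕ → ℤ → ℤ → Set
  Step D E X Y = (+ E Int.* X Int.≤ + D Int.* Y) × (+ D Int.* Y Int.< + E Int.* X Int.+ + D Int.* + E)

  step⇔increment : ∀ d e (X Y : ℤ) (u v : ℚ) →
    ℤ→ℚ X ≡ ℕ→ℚ (suc d) * u → ℤ→ℚ Y ≡ ℕ→ℚ (suc e) * v →
    Step (suc d) (suc e) X Y ⇔ ((0ℚ ≤ v - u) × (v - u < 1ℚ))
  step⇔increment d e X Y u v X≡Du Y≡Ev = lower ×-⇔ upper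
    where
    D = ℕ→ℚ (suc d)
    E = ℕ→ℚ (suc e)
    -- D·E = 1 + de
    de = e Nat.+ d Nat.* suc e
    a = ℤ→ℚ (+ suc e Int.* X)
    identity : D * (E * v) ≡ E * (D * u) + D * E * (v - u)
    identity = solve 4 (λ D E u v → D :* (E :* v) := E :* (D :* u) :+ D :* E :* (v :- u)) refl D E u v
    key : ℤ→ℚ (+ suc d Int.* Y) ≡ a + pos de * (v - u)
    key = begin
      ℤ→ℚ (+ suc d Int.* Y)        ≡⟨ trans (ι-* (+ suc d) Y) (cong (D *_) Y≡Ev) ⟩
      D * (E * v)                  ≡⟨ identity ⟩
      E * (D * u) + D * E * (v - u) ≡⟨ cong₂ (λ p q → p + q * (v - u))
                                          (sym (trans (ι-* (+ suc e) X) (cong (E *_) X≡Du)))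
                                          (trans (sym (ι-* (+ suc d) (+ suc e))) (ι-pos de)) ⟩
      a + pos de * (v - u)           ∎
      where open ≡-Reasoning
    lower : (+ suc e Int.* X Int.≤ + suc d Int.* Y) ⇔ (0ℚ ≤ v - u)
    lower = ⇔-trans ι-≤ (subst (λ r → (a ≤ r) ⇔ (0ℚ ≤ v - u)) (sym key) (affine-≤ a de (v - u)))
    top : ℤ→ℚ (+ suc e Int.* X Int.+ + suc d Int.* + suc e) ≡ a + pos de
    top = trans (ι-+ (+ suc e Int.* X) (+ suc de)) (cong (λ r → a + r) (ι-pos de))
    upper : (+ suc d Int.* Y Int.< + suc e Int.* X Int.+ + suc d Int.* + suc e) ⇔ (v - u < 1ℚ)
    upper = ⇔-trans ι-< (subst₂ (λ r s → (r < s) ⇔ (v - u < 1ℚ)) (sym key) (sym top) (affine-< a de (v - u)))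

  partial : (ℕ → ℚ) → ℕ → ℚ
  partial f zero    = 0ℚ
  partial f (suc k) = f 0 + partial (λ j → f (suc j)) k

  partial-snoc : ∀ f k → partial f (suc k) ≡ partial f k + f k
  partial-snoc f zero    = trans (ℚP.+-identityʳ (f 0)) (sym (ℚP.+-identityˡ (f 0)))
  partial-snoc f (suc k) =
    trans (cong (λ r → f 0 + r) (partial-snoc (λ j → f (suc j)) k)) (sym (ℚP.+-assoc (f 0) _ _))

  partial-cong : ∀ f g k → (∀ j → j Nat.< k → f j ≡ g j) → partial f k ≡ partial g k
  partial-cong f g zero    h = refl
  partial-cong f g (suc k) h =
    cong₂ _+_ (h 0 (s≤s z≤n)) (partial-cong (λ j → f (suc j)) (λ j → g (suc j)) k (λ j p → h (suc j) (s≤s p)))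

  telescope : ∀ q k → partial (λ j → q (suc j) - q j) k ≡ q k - q 0
  telescope q zero    = sym (ℚP.+-inverseʳ (q 0))
  telescope q (suc k) = trans (cong (λ r → (q 1 - q 0) + r) (telescope (λ j → q (suc j)) k))
    (solve 3 (λ q₀ q₁ qₖ → (q₁ :- q₀) :+ (qₖ :- q₁) := qₖ :- q₀) refl (q 0) (q 1) (q (suc k)))

  ∑-cong : ∀ {m} (f g : Fin m → ℚ) → (∀ j → f j ≡ g j) → ∑ f ≡ ∑ g
  ∑-cong {zero}  f g h = refl
  ∑-cong {suc m} f g h = cong₂ _+_ (h fzero) (∑-cong (λ j → f (fsuc j)) (λ j → g (fsuc j)) (λ j → h (fsuc j)))

  ∑-zero : ∀ {m} (g : Fin m → ℚ) → ∑ (λ j → g j * 0ℚ) ≡ 0ℚ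
  ∑-zero {zero}  g = refl
  ∑-zero {suc m} g = trans (cong₂ _+_ (ℚP.*-zeroʳ (g fzero)) (∑-zero (λ j → g (fsuc j)))) (ℚP.+-identityʳ 0ℚ)

  -- The i-th coordinate of ∑_j c_j·w_j is L·(c_0 + ⋯ + c_i), where L = t_i: the vector w_j
  -- has coordinate t_i at the positions i ≥ j and 0 before.
  column-sum : ∀ m (g : ℕ → ℚ) (L i : ℕ) → i Nat.< m →
    ∑ {m} (λ j → g (toℕ j) * ℕ→ℚ (if i <ᵇ toℕ j then 0 else L)) ≡ ℕ→ℚ L * partial g (suc i)
  column-sum (suc m) g L zero    _ = begin
    g 0 * ℕ→ℚ L + ∑ {m} (λ j → g (suc (toℕ j)) * 0ℚ)
      ≡⟨ cong (λ r → g 0 * ℕ→ℚ L + r) (∑-zero {m} (λ j → g (suc (toℕ j)))) ⟩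
    g 0 * ℕ→ℚ L + 0ℚ
      ≡⟨ solve 2 (λ g₀ L → g₀ :* L :+ con 0ℚ := L :* (g₀ :+ con 0ℚ)) refl (g 0) (ℕ→ℚ L) ⟩
    ℕ→ℚ L * (g 0 + 0ℚ)                            ∎
    where open ≡-Reasoning
  column-sum (suc m) g L (suc i) (s≤s i<m) = begin
    g 0 * ℕ→ℚ L + ∑ {m} (λ j → g (suc (toℕ j)) * ℕ→ℚ (if i <ᵇ toℕ j then 0 else L))
      ≡⟨ cong (λ r → g 0 * ℕ→ℚ L + r) (column-sum m (λ j → g (suc j)) L i i<m) ⟩
    g 0 * ℕ→ℚ L + ℕ→ℚ L * partial (λ j → g (suc j)) (suc i)
      ≡⟨ solve 3 (λ g₀ L s → g₀ :* L :+ L :* s := L :* (g₀ :+ s)) refl (g 0) (ℕ→ℚ L) _ ⟩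
    ℕ→ℚ L * partial g (suc (suc i))  ∎
    where open ≡-Reasoning

  coordinate : ∀ {m} (t : Vec ℕ m) (c : Vec ℚ m) (i : Fin m) →
    ∑ (λ j → lookup c j * ℕ→ℚ (w t j i)) ≡ ℕ→ℚ (lookup t i) * partial (at 0ℚ c) (suc (toℕ i))
  coordinate {m} t c i =
    trans (∑-cong _ _ (λ j → cong (_* ℕ→ℚ (w t j i)) (sym (at-lookup c j))))
          (column-sum m (at 0ℚ c) (lookup t i) (toℕ i) (FinP.toℕ<n i))

module Remainders where
  open import Data.Integer using (_+_; _*_; _-_; -_; -[1+_])
  import Data.Integer.Properties as ℤP
  open import Data.Integer.DivMod using (_/ℕ_; a≡a%ℕn+[a/ℕn]*n; n%ℕd<d)
  open import Data.Integer.Tactic.RingSolver using (solve-∀)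
  open Nat using (_<_; _≤_)

  negRem-< : ∀ x e → negRem x (suc e) < suc e
  negRem-< x e = n%ℕd<d (- x) (suc e)

  -- x ≡ −negRem x E (mod E): x = E·B − negRem x E, where B = −((−x) div E).
  negRem-quotient : ∀ x e → Σ ℤ λ B → x ≡ + suc e * B - + negRem x (suc e)
  negRem-quotient x e = - Q , (begin
    x                                      ≡⟨ sym (ℤP.neg-involutive x) ⟩
    - (- x)                                ≡⟨ cong -_ (a≡a%ℕn+[a/ℕn]*n (- x) (suc e)) ⟩
    - (+ r + Q * + suc e)                  ≡⟨ rearrange (+ r) Q (+ suc e) ⟩
    + suc e * - Q - + r                    ∎)
    where
    open ≡-Reasoning
    r = negRem x (suc e)
    Q = (- x) /ℕ suc e
    rearrange : ∀ r Q E → - (r + Q * E) ≡ E * - Q - r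
    rearrange = solve-∀

  residues-equal : ∀ {E r z} q → r < E → z < E → + r ≡ + z + q * + E → r ≡ z
  residues-equal {E} {r} {z} (+ zero) r<E z<E r≡ = ℤP.+-injective (trans r≡ (ℤP.+-identityʳ (+ z)))
  residues-equal {E} {r} {z} (+ suc j) r<E z<E r≡ = ⊥-elim (ℕP.<⇒≱ r<E E≤r)
    where
    r≡z+jE : r ≡ z Nat.+ suc j Nat.* E
    r≡z+jE = ℤP.+-injective (trans r≡ (cong (λ y → + z + y) (sym (ℤP.pos-* (suc j) E))))
    E≤r : E ≤ r
    E≤r = ℕP.≤-trans (ℕP.m≤m+n E (j Nat.* E)) (ℕP.≤-trans (ℕP.m≤n+m _ z) (ℕP.≤-reflexive (sym r≡z+jE)))
  residues-equal {E} {r} {z} -[1+ j ] r<E z<E r≡ = ⊥-elim (ℕP.<⇒≱ z<E E≤z)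
    where
    cancel : ∀ z J E → z + (- J) * E + J * E ≡ z
    cancel = solve-∀
    r+jE≡z : r Nat.+ suc j Nat.* E ≡ z
    r+jE≡z = ℤP.+-injective (begin
      + r + + (suc j Nat.* E)                 ≡⟨ cong₂ _+_ r≡ (ℤP.pos-* (suc j) E) ⟩
      + z + -[1+ j ] * + E + + suc j * + E    ≡⟨ cancel (+ z) (+ suc j) (+ E) ⟩
      + z                                     ∎)
      where open ≡-Reasoning
    E≤z : E ≤ z
    E≤z = ℕP.≤-trans (ℕP.m≤m+n E (j Nat.* E)) (ℕP.≤-trans (ℕP.m≤n+m _ r) (ℕP.≤-reflexive r+jE≡z))

  negRem-unique : ∀ {x e z} B → z < suc e → x ≡ + suc e * B - + z → negRem x (suc e) ≡ z
  negRem-unique {x} {e} {z} B z<E x≡ =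
    residues-equal (- B - Q) (negRem-< x e) z<E (begin
      + r                       ≡⟨ sym (shift (+ r) Q (+ suc e)) ⟩
      + r + Q * + suc e - Q * + suc e  ≡⟨ cong (λ y → y - Q * + suc e) (sym (a≡a%ℕn+[a/ℕn]*n (- x) (suc e))) ⟩
      - x - Q * + suc e         ≡⟨ cong (λ y → - y - Q * + suc e) x≡ ⟩
      - (+ suc e * B - + z) - Q * + suc e  ≡⟨ regroup (+ z) B Q (+ suc e) ⟩
      + z + (- B - Q) * + suc e ∎)
    where
    open ≡-Reasoning
    r = negRem x (suc e)
    Q = (- x) /ℕ suc e
    shift : ∀ r Q E → r + Q * E - Q * E ≡ r
    shift = solve-∀
    regroup : ∀ z B Q E → - (E * B - z) - Q * E ≡ z + (- B - Q) * E
    regroup = solve-∀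

-- Step (2): the integer window argument.
module Window where
  open import Data.Integer using (_+_; _*_; _-_; -_; -[1+_]; +≤+; +<+) renaming (_≤_ to _≤ℤ_; _<_ to _<ℤ_)
  import Data.Integer.Properties as ℤP
  open import Data.Integer.Tactic.RingSolver using (solve-∀)
  open Nat using (_<_; _≤_) renaming (_+_ to _+ℕ_; _*_ to _*ℕ_)
  open Ascents using (bit; bit-<; bit-≮)
  open IntegerShift
  open LocalInequalities using (Step)

  window-ℕ : ∀ {F a b} j → a < F → b < F → a ≤ F *ℕ j +ℕ b → F *ℕ j +ℕ b < F +ℕ a → j ≡ bit b a
  window-ℕ {F} {a} {b} zero a<F b<F lo hi =
    sym (bit-≮ (ℕP.≤⇒≯ (subst (a ≤_) (cong (_+ℕ b) (ℕP.*-zeroʳ F)) lo)))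
  window-ℕ {F} {a} {b} (suc zero) a<F b<F lo hi =
    sym (bit-< (ℕP.+-cancelˡ-< F b a (subst (λ y → y +ℕ b < F +ℕ a) (ℕP.*-identityʳ F) hi)))
  window-ℕ {F} {a} {b} (suc (suc j)) a<F b<F lo hi = ⊥-elim (ℕP.<-irrefl refl (ℕP.<-trans hi F+a<))
    where
    open ℕP.≤-Reasoning
    F+a< : F +ℕ a < F *ℕ suc (suc j) +ℕ b
    F+a< = begin-strict
      F +ℕ a                         <⟨ ℕP.+-monoʳ-< F a<F ⟩
      F +ℕ F                         ≤⟨ ℕP.+-monoʳ-≤ F (ℕP.m≤m+n F (F *ℕ j)) ⟩
      F +ℕ (F +ℕ F *ℕ j)             ≡⟨ cong (F +ℕ_) (sym (ℕP.*-suc F j)) ⟩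
      F +ℕ F *ℕ suc j                ≡⟨ sym (ℕP.*-suc F (suc j)) ⟩
      F *ℕ suc (suc j)               ≤⟨ ℕP.m≤m+n _ b ⟩
      F *ℕ suc (suc j) +ℕ b          ∎

  window-ℕ⁻ : ∀ {F a b} → a < F → b < F → (a ≤ F *ℕ bit b a +ℕ b) × (F *ℕ bit b a +ℕ b < F +ℕ a)
  window-ℕ⁻ {F} {a} {b} a<F b<F with b ℕP.<? a
  ... | yes b<a rewrite bit-< b<a | ℕP.*-identityʳ F =
    ℕP.≤-trans (ℕP.<⇒≤ a<F) (ℕP.m≤m+n F b) , ℕP.+-monoʳ-< F b<a
  ... | no b≮a rewrite bit-≮ b≮a | ℕP.*-zeroʳ F =
    ℕP.≮⇒≥ b≮a , ℕP.<-≤-trans b<F (ℕP.m≤m+n F a)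

  -- The same statement over ℤ: a negative j is impossible since then F·j + b < 0 ≤ a.
  window : ∀ {F a b} (q : ℤ) → a < F → b < F →
    ((+ a ≤ℤ + F * q + + b) × (+ F * q + + b <ℤ + F + + a)) ⇔ (q ≡ + bit b a)
  window {F} {a} {b} q a<F b<F = mk⇔ (solution q) (λ { refl → satisfied })
    where
    as-ℕ : ∀ j → + F * + j + + b ≡ + (F *ℕ j +ℕ b)
    as-ℕ j = cong (_+ + b) (sym (ℤP.pos-* F j))
    solution : ∀ q → (+ a ≤ℤ + F * q + + b) × (+ F * q + + b <ℤ + F + + a) → q ≡ + bit b a
    solution (+ j) (lo , hi) = cong +_ (window-ℕ j a<F b<F
      (ℤP.drop‿+≤+ (subst (+ a ≤ℤ_) (as-ℕ j) lo)) (ℤP.drop‿+<+ (subst (_<ℤ + F + + a) (as-ℕ j) hi)))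
    solution -[1+ j ] (lo , hi) = ⊥-elim (ℕP.<⇒≱ b<F (ℕP.≤-trans (ℕP.m≤n*m F (suc j))
                                                        (ℕP.≤-trans (ℕP.m≤n+m _ a) a+jF≤b)))
      where
      cancel : ∀ F J b → F * (- J) + b + J * F ≡ b
      cancel = solve-∀
      a+jF≤b : a +ℕ suc j *ℕ F ≤ b
      a+jF≤b = ℤP.drop‿+≤+ (to (≤-shift (+ suc j * + F) (cong (λ y → + a + y) (sym (ℤP.pos-* (suc j) F)))
                                                      (cancel (+ F) (+ suc j) (+ b))) lo)
    satisfied : (+ a ≤ℤ + F * + bit b a + + b) × (+ F * + bit b a + + b <ℤ + F + + a)
    satisfied = let lo , hi = window-ℕ⁻ {F} a<F b<F in
      subst (+ a ≤ℤ_) (sym (as-ℕ (bit b a))) (+≤+ lo) , subst (_<ℤ + F + + a) (sym (as-ℕ (bit b a))) (+<+ hi)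

  -- Write x_{k-1} = D·A − z with 0 ≤ z < D and
  -- x_k = E·B − z' with 0 ≤ z' < E. Then the local inequalities hold exactly when B − A
  -- is the weighted ascent indicator [z/D < z'/E] = [E·z < D·z'].
  step⇔ascent : ∀ d e {z z'} (A B : ℤ) → z < suc d → z' < suc e →
    Step (suc d) (suc e) (+ suc d * A - + z) (+ suc e * B - + z') ⇔ (B ≡ A + + bit (suc e *ℕ z) (suc d *ℕ z'))
  step⇔ascent d e {z} {z'} A B z<D z'<E =
    ⇔-trans (lower ×-⇔ upper) (⇔-trans (window (B - A) a<F b<F) difference)
    where
    D = + suc d
    E = + suc e
    F = suc d *ℕ suc e
    a = suc d *ℕ z'
    b = suc e *ℕ z
    -- adding K to both sides of both inequalities puts them in the form of the window lemma
    K = D * + z' + E * + z - D * E * A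
    ring₁ : ∀ D E A z z' → E * (D * A - z) + (D * z' + E * z - D * E * A) ≡ D * z'
    ring₁ = solve-∀
    ring₂ : ∀ D E A B z z' → D * (E * B - z') + (D * z' + E * z - D * E * A) ≡ D * E * (B - A) + E * z
    ring₂ = solve-∀
    ring₃ : ∀ D E A z z' → E * (D * A - z) + D * E + (D * z' + E * z - D * E * A) ≡ D * E + D * z'
    ring₃ = solve-∀
    +a : D * + z' ≡ + a
    +a = sym (ℤP.pos-* (suc d) z')
    +F : D * E ≡ + F
    +F = sym (ℤP.pos-* (suc d) (suc e))
    +b : E * + z ≡ + b
    +b = sym (ℤP.pos-* (suc e) z)
    lower : (E * (D * A - + z) ≤ℤ D * (E * B - + z')) ⇔ (+ a ≤ℤ + F * (B - A) + + b)
    lower = ≤-shift K (trans (ring₁ D E A (+ z) (+ z')) +a)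
                      (trans (ring₂ D E A B (+ z) (+ z')) (cong₂ (λ f y → f * (B - A) + y) +F +b))
    upper : (D * (E * B - + z') <ℤ E * (D * A - + z) + D * E) ⇔ (+ F * (B - A) + + b <ℤ + F + + a)
    upper = <-shift K (trans (ring₂ D E A B (+ z) (+ z')) (cong₂ (λ f y → f * (B - A) + y) +F +b))
                      (trans (ring₃ D E A (+ z) (+ z')) (cong₂ _+_ +F +a))
    a<F : a < F
    a<F = ℕP.*-monoʳ-< (suc d) z'<E
    b<F : b < F
    b<F = subst (b <_) (ℕP.*-comm (suc e) (suc d)) (ℕP.*-monoʳ-< (suc e) z<D)
    difference : (B - A ≡ + bit b a) ⇔ (B ≡ A + + bit b a)
    difference = mk⇔ (λ eq → trans (add-back A B) (cong (λ y → A + y) eq)) (λ eq → trans (cong (_- A) eq) (take-off A _))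
      where
      add-back : ∀ A B → B ≡ A + (B - A)
      add-back = solve-∀
      take-off : ∀ A c → A + c - A ≡ c
      take-off = solve-∀

module Weighted {m : ℕ} (t : Vec ℕ m) (d : ℕ → ℕ) (t≡ : ∀ i → lookup t i ≡ suc (d (toℕ i))) where
  open import Data.Rational using (ℚ; 0ℚ; 1ℚ; _*_; _-_; _≤_; _<_; 1/_)
  import Data.Rational.Properties as ℚP
  open import Data.Rational.Solver using (module +-*-Solver)
  open +-*-Solver using (solve; _:=_; _:+_; _:-_)
  import Data.Integer as Int
  open Nat using () renaming (_<_ to _<ℕ_; _≤_ to _≤ℕ_; _*_ to _*ℕ_)
  open Sequences
  open Rationals using (pos; *-/pos)
  open LocalInequalities
  open Ascents using (bit)
  open Window using (step⇔ascent)

  -- Sentinels: the weight t_{-1} = 1 + 0 and coordinate x_{-1} = 0 sit at index 0 of the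
  -- padded sequences d⁺ and coord⁺ x, so that index k + 1 of a padded sequence is coordinate k.
  d⁺ : ℕ → ℕ
  d⁺ = 0 ◂ d

  coord : Vec ℤ m → ℕ → ℤ
  coord x = at (+ 0) x

  coord⁺ : Vec ℤ m → ℕ → ℤ
  coord⁺ x = + 0 ◂ coord x

  Steps : Vec ℤ m → Set
  Steps x = ∀ k → k <ℕ m → Step (suc (d⁺ k)) (suc (d k)) (coord⁺ x k) (coord x k)

  weighted-sum : ∀ (c : Vec ℚ m) i →
    ∑ (λ j → lookup c j * ℕ→ℚ (w t j i)) ≡ ℕ→ℚ (suc (d (toℕ i))) * partial (at 0ℚ c) (suc (toℕ i))
  weighted-sum c i = trans (coordinate t c i) (cong (λ l → ℕ→ℚ l * partial (at 0ℚ c) (suc (toℕ i))) (t≡ i))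

  par⇒steps : ∀ x → InPar t x → Steps x
  par⇒steps x (c , bounds , sums) k k<m =
    from (step⇔increment (d⁺ k) (d k) (coord⁺ x k) (coord x k) (S k) (S (suc k)) (previous k k<m) (current k<m))
         (subst (λ r → (0ℚ ≤ r) × (r < 1ℚ)) (sym increment) c-bounds)
    where
    S = partial (at 0ℚ c)
    current : ∀ {k} → k <ℕ m → ℤ→ℚ (coord x k) ≡ ℕ→ℚ (suc (d k)) * S (suc k)
    current {k} k<m = begin
      ℤ→ℚ (coord x k)                          ≡⟨ cong ℤ→ℚ (sym (at-lookup-fromℕ< x k<m)) ⟩
      ℤ→ℚ (lookup x i)                         ≡⟨ trans (sums i) (weighted-sum c i) ⟩
      ℕ→ℚ (suc (d (toℕ i))) * S (suc (toℕ i))  ≡⟨ cong (λ j → ℕ→ℚ (suc (d j)) * S (suc j)) (FinP.toℕ-fromℕ< k<m) ⟩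
      ℕ→ℚ (suc (d k)) * S (suc k)              ∎
      where
      open ≡-Reasoning
      i = fromℕ< k<m
    previous : ∀ k → k <ℕ m → ℤ→ℚ (coord⁺ x k) ≡ ℕ→ℚ (suc (d⁺ k)) * S k
    previous zero    _   = refl
    previous (suc k) k<m = current (ℕP.<-trans (ℕP.n<1+n k) k<m)
    increment : S (suc k) - S k ≡ at 0ℚ c k
    increment = trans (cong (_- S k) (partial-snoc (at 0ℚ c) k))
                      (solve 2 (λ s c → s :+ c :- s := c) refl (S k) (at 0ℚ c k))
    c-bounds : (0ℚ ≤ at 0ℚ c k) × (at 0ℚ c k < 1ℚ)
    c-bounds = subst (λ r → (0ℚ ≤ r) × (r < 1ℚ)) (at-lookup-fromℕ< c k<m) (bounds (fromℕ< k<m))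

  steps⇒par : ∀ x → Steps x → InPar t x
  steps⇒par x steps = c , bounds , sums
    where
    -- q k = x_{k-1} / t_{k-1}, so that c_k = q (k+1) − q k
    q : ℕ → ℚ
    q k = ℤ→ℚ (coord⁺ x k) * 1/ pos (d⁺ k)
    scaled : ∀ k → ℤ→ℚ (coord⁺ x k) ≡ ℕ→ℚ (suc (d⁺ k)) * q k
    scaled k = sym (*-/pos (d⁺ k) (ℤ→ℚ (coord⁺ x k)))
    increment : ℕ → ℚ
    increment k = q (suc k) - q k
    c : Vec ℚ m
    c = tabulate (λ i → increment (toℕ i))
    bounds : ∀ j → (0ℚ ≤ lookup c j) × (lookup c j < 1ℚ)
    bounds j = subst (λ r → (0ℚ ≤ r) × (r < 1ℚ)) (sym (VecP.lookup∘tabulate (λ i → increment (toℕ i)) j))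
      (to (step⇔increment (d⁺ k) (d k) _ _ (q k) (q (suc k)) (scaled k) (scaled (suc k))) (steps k (FinP.toℕ<n j)))
      where k = toℕ j
    sums : ∀ i → ℤ→ℚ (lookup x i) ≡ ∑ (λ j → lookup c j * ℕ→ℚ (w t j i))
    sums i = begin
      ℤ→ℚ (lookup x i)                                   ≡⟨ cong ℤ→ℚ (sym (at-lookup x i)) ⟩
      ℤ→ℚ (coord x k)                                    ≡⟨ scaled (suc k) ⟩
      ℕ→ℚ (suc (d k)) * q (suc k)
        ≡⟨ cong (ℕ→ℚ (suc (d k)) *_) (sym (telescope-from-0 (suc k))) ⟩
      ℕ→ℚ (suc (d k)) * partial increment (suc k)
        ≡⟨ cong (ℕ→ℚ (suc (d k)) *_) (partial-cong _ _ (suc k) same-terms) ⟩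
      ℕ→ℚ (suc (d k)) * partial (at 0ℚ c) (suc k)        ≡⟨ sym (weighted-sum c i) ⟩
      ∑ (λ j → lookup c j * ℕ→ℚ (w t j i))               ∎
      where
      open ≡-Reasoning
      k = toℕ i
      telescope-from-0 : ∀ k → partial increment k ≡ q k
      telescope-from-0 k = trans (telescope q k) (ℚP.+-identityʳ (q k))
      same-terms : ∀ j → j <ℕ suc k → increment j ≡ at 0ℚ c j
      same-terms j j≤k = sym (at-tabulate-toℕ increment (ℕP.<-≤-trans j≤k (FinP.toℕ<n i)))

  par⇔steps : ∀ x → InPar t x ⇔ Steps x
  par⇔steps x = mk⇔ (par⇒steps x) (steps⇒par x)

  -- For a sequence z (meant to satisfy z_k < t_k), with the
  -- sentinel z_{-1} = 0 at index 0 of 0 ◂ z, position k is a weighted ascent when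
  -- z_{k-1}/t_{k-1} < z_k/t_k.
  rem : Vec ℤ m → ℕ → ℕ
  rem x = at 0 (REMbar t x)

  Box : (ℕ → ℕ) → Set
  Box z = ∀ k → k <ℕ m → z k <ℕ suc (d k)

  wbit : (ℕ → ℕ) → ℕ → ℕ
  wbit z k = bit (suc (d k) *ℕ (0 ◂ z) k) (suc (d⁺ k) *ℕ z k)

  wasc : (ℕ → ℕ) → ℕ → ℕ
  wasc z zero    = 0
  wasc z (suc k) = wasc z k Nat.+ wbit z k

  -- The closed form of a point of Par_t in terms of its remainders: x_k = t_k·wasc z (k+1) − z_k,
  -- stated at padded index k (where index 0 is the trivially true sentinel case).
  ClosedForm⁺ : Vec ℤ m → (ℕ → ℕ) → ℕ → Set
  ClosedForm⁺ x z k = coord⁺ x k ≡ + suc (d⁺ k) Int.* + wasc z k Int.- + (0 ◂ z) k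

  ClosedForm : Vec ℤ m → (ℕ → ℕ) → Set
  ClosedForm x z = ∀ k → k <ℕ m → ClosedForm⁺ x z (suc k)

  rem-at : ∀ x {k} → k <ℕ m → rem x k ≡ negRem (coord x k) (suc (d k))
  rem-at x {k} k<m = trans (at-tabulate _ k<m)
    (cong₂ negRem (at-lookup-fromℕ< x k<m) (trans (t≡ (fromℕ< k<m)) (cong (λ j → suc (d j)) (FinP.toℕ-fromℕ< k<m))))

  rem-box : ∀ x → Box (rem x)
  rem-box x k k<m = subst (_<ℕ suc (d k)) (sym (rem-at x k<m)) (Remainders.negRem-< (coord x k) (d k))

  step⇔closed-form : ∀ x z k → Box z → k <ℕ m → ClosedForm⁺ x z k → (B : ℤ) →
    coord x k ≡ + suc (d k) Int.* B Int.- + z k →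
    Step (suc (d⁺ k)) (suc (d k)) (coord⁺ x k) (coord x k) ⇔ (B ≡ + wasc z (suc k))
  step⇔closed-form x z k box k<m prev B cur rewrite prev | cur =
    step⇔ascent (d⁺ k) (d k) (+ wasc z k) B (previous-box k k<m) (box k k<m)
    where
    previous-box : ∀ k → k <ℕ m → (0 ◂ z) k <ℕ suc (d⁺ k)
    previous-box zero    _   = s≤s z≤n
    previous-box (suc k) k<m = box k (ℕP.<-trans (ℕP.n<1+n k) k<m)

  wasc-cong : ∀ z z′ k → (∀ j → j <ℕ k → z j ≡ z′ j) → wasc z k ≡ wasc z′ k
  wasc-cong z z′ zero    same = refl
  wasc-cong z z′ (suc k) same = cong₂ Nat._+_ (wasc-cong z z′ k (λ j j<k → same j (ℕP.m<n⇒m<1+n j<k)))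
    (cong₂ (λ p c → bit (suc (d k) *ℕ p) (suc (d⁺ k) *ℕ c)) (same-previous k ℕP.≤-refl) (same k ℕP.≤-refl))
    where
    same-previous : ∀ j → j ≤ℕ k → (0 ◂ z) j ≡ (0 ◂ z′) j
    same-previous zero    _   = refl
    same-previous (suc j) j<k = same j (ℕP.m<n⇒m<1+n j<k)

  steps⇒closed-form : ∀ x → Steps x → ClosedForm x (rem x)
  steps⇒closed-form x steps k k<m = closed⁺ (suc k) k<m
    where
    closed⁺ : ∀ k → k ≤ℕ m → ClosedForm⁺ x (rem x) k
    closed⁺ zero    _   = refl
    closed⁺ (suc k) k<m with Remainders.negRem-quotient (coord x k) (d k)
    ... | B , x≡EB-r = subst (λ B′ → coord x k ≡ + suc (d k) Int.* B′ Int.- + rem x k) B≡wasc quotient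
      where
      quotient : coord x k ≡ + suc (d k) Int.* B Int.- + rem x k
      quotient = trans x≡EB-r (cong (λ r → + suc (d k) Int.* B Int.- + r) (sym (rem-at x k<m)))
      B≡wasc : B ≡ + wasc (rem x) (suc k)
      B≡wasc = to (step⇔closed-form x (rem x) k (rem-box x) k<m (closed⁺ k (ℕP.<⇒≤ k<m)) B quotient) (steps k k<m)
  closed-form⇒steps : ∀ x z → Box z → ClosedForm x z → Steps x
  closed-form⇒steps x z box closed k k<m =
    from (step⇔closed-form x z k box k<m (previous k k<m) (+ wasc z (suc k)) (closed k k<m)) refl
    where
    previous : ∀ k → k <ℕ m → ClosedForm⁺ x z k
    previous zero    _   = refl
    previous (suc k) k<m = closed k (ℕP.<-trans (ℕP.n<1+n k) k<m)

  par⇒closed-form : ∀ x → InPar t x → ClosedForm x (rem x)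
  par⇒closed-form x px = steps⇒closed-form x (to (par⇔steps x) px)

  rem-injective : ∀ x y → InPar t x → InPar t y → (∀ k → k <ℕ m → rem x k ≡ rem y k) → x ≡ y
  rem-injective x y px py same = at-ext x y λ k k<m → begin
    coord x k                                                 ≡⟨ par⇒closed-form x px k k<m ⟩
    + suc (d k) Int.* + wasc (rem x) (suc k) Int.- + rem x k ≡⟨ cong₂ (λ a r → + suc (d k) Int.* + a Int.- + r)
                                                                  (wasc-cong (rem x) (rem y) (suc k)
                                                                     (λ j j≤k → same j (ℕP.<-≤-trans j≤k k<m)))
                                                                  (same k k<m) ⟩
    + suc (d k) Int.* + wasc (rem y) (suc k) Int.- + rem y k ≡⟨ sym (par⇒closed-form y py k k<m) ⟩
    coord y k                                                 ∎
    where open ≡-Reasoning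

  -- … and onto the box ∏_k ⟨t_k − 1⟩: the preimage of z is given by the closed form.
  rem-surjective : ∀ z → Box z → Σ (Vec ℤ m) λ x → InPar t x × (∀ k → k <ℕ m → rem x k ≡ z k)
  rem-surjective z box = x , from (par⇔steps x) (closed-form⇒steps x z box closed) , remainders
    where
    coordinate-of : ℕ → ℤ
    coordinate-of k = + suc (d k) Int.* + wasc z (suc k) Int.- + z k
    x : Vec ℤ m
    x = tabulate (λ i → coordinate-of (toℕ i))
    closed : ClosedForm x z
    closed k k<m = at-tabulate-toℕ coordinate-of k<m
    remainders : ∀ k → k <ℕ m → rem x k ≡ z k
    remainders k k<m = trans (rem-at x k<m) (Remainders.negRem-unique (+ wasc z (suc k)) (box k k<m) (closed k k<m))

module InversionSequences where
  open Nat using (_<_; _≤_)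
  open Sequences

  suc-∸ : ∀ {k n} → k < n → suc (n ∸ suc k) ≡ n ∸ k
  suc-∸ k<n = sym (ℕP.+-∸-assoc 1 k<n)

  ∸-suc-< : ∀ {k n} → k < n → n ∸ suc k < n
  ∸-suc-< {k} {n} k<n = subst (_≤ n) (sym (suc-∸ k<n)) (ℕP.m∸n≤m n k)

  reverse-box⇒invSeq : (r : Vec ℕ n) → (∀ k → k < n → at 0 r k < suc k) → InvSeq n (reverse r)
  reverse-box⇒invSeq {n} r box i = subst₂ _<_ (trans (sym (at-reverse r i<n)) (at-lookup (reverse r) i)) (suc-∸ i<n)
                                          (box (n ∸ suc (toℕ i)) (∸-suc-< i<n))
    where i<n = FinP.toℕ<n i

  invSeq⇒reverse-box : (e : Vec ℕ n) → InvSeq n e → ∀ k → k < n → at 0 (reverse e) k < suc k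
  invSeq⇒reverse-box {n} e inv k k<n =
    subst₂ _<_ (trans (at-lookup-fromℕ< e j<n) (sym (at-reverse e k<n))) bound (inv (fromℕ< j<n))
    where
    j<n = ∸-suc-< k<n
    bound : n ∸ toℕ (fromℕ< j<n) ≡ suc k
    bound = trans (cong (n ∸_) (FinP.toℕ-fromℕ< j<n)) (ℕP.m∸[m∸n]≡n k<n)

module SStar (n : ℕ) where
  open import Data.Integer using (_*_; _-_)
  import Data.Integer.Properties as ℤP
  open Nat using (_<_; _≤_) renaming (_+_ to _+ℕ_; _*_ to _*ℕ_)
  open Sequences
  open Ascents

  d : ℕ → ℕ
  d k = if k <ᵇ n then k else 0

  d-< : ∀ {k} → k < n → d k ≡ k
  d-< {k} k<n with k <ᵇ n in eq
  ... | true  = refl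
  ... | false = ⊥-elim (subst T eq (ℕP.<⇒<ᵇ k<n))

  d-n : d n ≡ 0
  d-n with n <ᵇ n in eq
  ... | true  = ⊥-elim (ℕP.<-irrefl refl (ℕP.<ᵇ⇒< n n (subst T (sym eq) _)))
  ... | false = refl

  d-0 : d 0 ≡ 0
  d-0 with 0 <ᵇ n
  ... | true  = refl
  ... | false = refl

  sStar-lookup : ∀ i → lookup (sStar n) i ≡ suc (d (toℕ i))
  sStar-lookup i = trans (sym (at-lookup (sStar n) i)) (weight (toℕ i) (FinP.toℕ<n i))
    where
    increasing : Vec ℕ n
    increasing = tabulate (λ i → suc (toℕ i))
    weight : ∀ k → k < suc n → at 0 (sStar n) k ≡ suc (d k)
    weight k k<1+n with ℕP.m≤n⇒m<n∨m≡n (Nat.s≤s⁻¹ k<1+n)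
    ... | inj₁ k<n  = trans (at-∷ʳ increasing 1 k<n) (trans (at-tabulate-toℕ suc k<n) (cong suc (sym (d-< k<n))))
    ... | inj₂ refl = trans (at-∷ʳ-end increasing 1) (cong suc (sym d-n))

  open Weighted (sStar n) d sStar-lookup public

  -- In the box, the last remainder is 0 since t_n = 1.
  last-zero : ∀ z → Box z → z n ≡ 0
  last-zero z box = ℕP.n<1⇒n≡0 (subst (λ a → z n < suc a) d-n (box n (ℕP.n<1+n n)))

  -- For s*, weighted ascents of a sequence in the box are ordinary ascents: for k < n the
  -- comparison z_{k-1}/k < z_k/(k+1) is z_{k-1} < z_k, and the last remainder z_n is 0.
  wasc≡ascents : ∀ z → Box z → ∀ k → k ≤ n → wasc z (suc k) ≡ ascents z (suc k)
  wasc≡ascents z box zero    _     rewrite ℕP.n<1⇒n≡0 (subst (λ a → z 0 < suc a) d-0 (box 0 (s≤s z≤n))) = refl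
  wasc≡ascents z box (suc k) 1+k≤n =
    cong₂ _+ℕ_ (wasc≡ascents z box k (ℕP.<⇒≤ 1+k≤n)) (weighted-bit (ℕP.m≤n⇒m<n∨m≡n 1+k≤n))
    where
    weighted-bit : (suc k < n) ⊎ (suc k ≡ n) →
      bit (suc (d (suc k)) *ℕ z k) (suc (d k) *ℕ z (suc k)) ≡ bit (z k) (z (suc k))
    weighted-bit (inj₁ 1+k<n) = begin
      bit (suc (d (suc k)) *ℕ z k) (suc (d k) *ℕ z (suc k))
        ≡⟨ cong₂ (λ a b → bit (suc a *ℕ z k) (suc b *ℕ z (suc k))) (d-< 1+k<n) (d-< k<n) ⟩
      bit (suc (suc k) *ℕ z k) (suc k *ℕ z (suc k))       ≡⟨ bit-scale (z (suc k)) zₖ<1+k ⟩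
      bit (z k) (z (suc k))                               ∎
      where
      open ≡-Reasoning
      k<n = ℕP.<-trans (ℕP.n<1+n k) 1+k<n
      zₖ<1+k = subst (λ a → z k < suc a) (d-< k<n) (box k (ℕP.m<n⇒m<1+n k<n))
    weighted-bit (inj₂ refl) rewrite last-zero z box | ℕP.*-zeroʳ (suc (d k)) = refl

  open InversionSequences

  π-rem : ∀ x {k} → k < n → at 0 (π (REMbar (sStar n) x)) k ≡ rem x k
  π-rem x k<n = at-init (REMbar (sStar n) x) k<n

  Φ-invSeq : ∀ x → InvSeq n (Φ n x)
  Φ-invSeq x = reverse-box⇒invSeq (π (REMbar (sStar n) x)) λ k k<n →
    subst₂ _<_ (sym (π-rem x k<n)) (cong suc (d-< k<n)) (rem-box x k (ℕP.m<n⇒m<1+n k<n))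

  Φ-injective : ∀ x y → InPar (sStar n) x → InPar (sStar n) y → Φ n x ≡ Φ n y → x ≡ y
  Φ-injective x y px py Φx≡Φy = rem-injective x y px py same
    where
    πx≡πy : π (REMbar (sStar n) x) ≡ π (REMbar (sStar n) y)
    πx≡πy = VecP.reverse-injective Φx≡Φy
    -- the first n remainders agree because Φ x = Φ y, the last ones are both 0
    same : ∀ k → k < suc n → rem x k ≡ rem y k
    same k k<1+n with ℕP.m≤n⇒m<n∨m≡n (Nat.s≤s⁻¹ k<1+n)
    ... | inj₁ k<n  = trans (sym (π-rem x k<n)) (trans (cong (λ v → at 0 v k) πx≡πy) (π-rem y k<n))
    ... | inj₂ refl = trans (last-zero (rem x) (rem-box x)) (sym (last-zero (rem y) (rem-box y)))

  reversed-box : ∀ e → InvSeq n e → Box (at 0 (reverse e))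
  reversed-box e inv k k<1+n with ℕP.m≤n⇒m<n∨m≡n (Nat.s≤s⁻¹ k<1+n)
  ... | inj₁ k<n  = subst (λ a → at 0 (reverse e) k < suc a) (sym (d-< k<n)) (invSeq⇒reverse-box e inv k k<n)
  ... | inj₂ refl = subst (_< suc (d n)) (sym (at-end (reverse e))) (s≤s z≤n)

  Φ-surjective : ∀ e → InvSeq n e → Σ (Vec ℤ (suc n)) λ x → InPar (sStar n) x × (Φ n x ≡ e)
  Φ-surjective e inv = x , proj₁ (proj₂ preimage) , trans (cong reverse π-rem≡reverse-e) (VecP.reverse-involutive e)
    where
    preimage : Σ (Vec ℤ (suc n)) λ x → InPar (sStar n) x × (∀ k → k < suc n → rem x k ≡ at 0 (reverse e) k)
    preimage = rem-surjective (at 0 (reverse e)) (reversed-box e inv)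
    x : Vec ℤ (suc n)
    x = proj₁ preimage
    π-rem≡reverse-e : π (REMbar (sStar n) x) ≡ reverse e
    π-rem≡reverse-e = at-ext _ _ λ k k<n → trans (π-rem x k<n) (proj₂ (proj₂ preimage) k (ℕP.m<n⇒m<1+n k<n))

  last-coordinate : ∀ x → InPar (sStar n) x → last x ≡ + ascents (rem x) n
  last-coordinate x px = begin
    last x                                               ≡⟨ last-at x ⟩
    coord x n                                            ≡⟨ par⇒closed-form x px n (ℕP.n<1+n n) ⟩
    + suc (d n) * + wasc (rem x) (suc n) - + rem x n     ≡⟨ cong₂ (λ a r → + suc a * + wasc (rem x) (suc n) - + r)
                                                              d-n (last-zero (rem x) (rem-box x)) ⟩
    + 1 * + wasc (rem x) (suc n) - + 0                   ≡⟨ trans (ℤP.+-identityʳ _) (ℤP.*-identityˡ _) ⟩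
    + wasc (rem x) (suc n)                               ≡⟨ cong +_ (wasc≡ascents (rem x) (rem-box x) n ℕP.≤-refl) ⟩
    + ascents (rem x) (suc n)                            ≡⟨ cong +_ (ascents-zero-end (rem x) n (last-zero (rem x) (rem-box x))) ⟩
    + ascents (rem x) n                                  ∎
    where open ≡-Reasoning

  Φ-statistics : ∀ x → InPar (sStar n) x →
    (last x ≡ + asc (toList (π (REMbar (sStar n) x)))) ×
    (asc (toList (π (REMbar (sStar n) x))) ≡ des (toList (reverse (π (REMbar (sStar n) x)))))
  Φ-statistics x px = trans (last-coordinate x px) (cong +_ ascents≡asc) , sym des≡asc
    where
    ascents≡asc : ascents (rem x) n ≡ asc (toList (π (REMbar (sStar n) x)))
    ascents≡asc = trans (ascents-cong _ _ n (λ k k<n → sym (π-rem x k<n))) (sym (asc-toList (π (REMbar (sStar n) x))))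
    des≡asc : des (toList (reverse (π (REMbar (sStar n) x)))) ≡ asc (toList (π (REMbar (sStar n) x)))
    des≡asc = trans (cong des (VecP.toList-reverse (π (REMbar (sStar n) x)))) (des-reverse (toList (π (REMbar (sStar n) x))))

proposition6p4 : (n : ℕ) →
    -- Φ maps Par_{s*} ∩ ℤ^{n+1} into inversion sequences
    ((x : Vec ℤ (suc n)) → InPar (sStar n) x → InvSeq n (Φ n x)) ×
    -- injective on Par_{s*} ∩ ℤ^{n+1}
    ((x y : Vec ℤ (suc n)) → InPar (sStar n) x → InPar (sStar n) y →
      Φ n x ≡ Φ n y → x ≡ y) ×
    -- surjective onto inversion sequences
    ((e : Vec ℕ n) → InvSeq n e →
      Σ (Vec ℤ (suc n)) λ x → InPar (sStar n) x × (Φ n x ≡ e)) ×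
    -- statistics
    ((x : Vec ℤ (suc n)) → InPar (sStar n) x →
      (last x ≡ + asc (toList (π (REMbar (sStar n) x)))) ×
      (asc (toList (π (REMbar (sStar n) x)))
        ≡ des (toList (reverse (π (REMbar (sStar n) x))))))
proposition6p4 n = (λ x _ → Φ-invSeq x) , Φ-injective , Φ-surjective , Φ-statistics
  where open SStar n
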